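{- Let $f(x)\in\mathbb{Z}[x]$ have degree $d\ge 2$ and let $t\in\mathbb{Z}$ be a wandering point for $f$. Let $g_1(x),\dots,g_k(x)$ be finitely many monic linear polynomials in $\mathbb{Z}[x]$. Then the following statements are equivalent: (i) $\delta_{f,t}\left(\bigcup_{i=1}^k \operatorname{Orb}^{\pm}_{g_i}(t)\right)=1$; (ii) $\delta_{f,t}\left(\operatorname{Orb}^{\pm}_{g_i}(t)\right)=1$ for some $i$ with $1\le i\le k$; (iii) $\operatorname{Orb}_f(t)\subset \operatorname{Orb}^{\pm}_{g_i}(t)$ for some $i$ with $1\le i\le k$.
   Context: For a polynomial $f$ and a point $t$, $f^0(x)=x$, $f^n=f\circ f^{n-1}$, and $\operatorname{Orb}_f(t)=\{f^n(t): n\ge 0\}$. The point $t$ is a wandering point for $f$ if $\operatorname{Orb}_f(t)$ is infinite. For a monic linear polynomial $g(x)=x+a$ with $a\in\mathbb{Z}$, $\operatorname{Orb}^{\pm}_g(t)=\{g^n(t):n\in\mathbb{Z}\}=\{t+na: n\in\mathbb{Z}\}$ (union of forward and backward orbits). For $f\in\mathbb{Z}[x]$, $s\in\mathbb{Z}$ and $A\subseteq\mathbb{Z}$, the relative density of $A$ in the orbit of $s$ under $f$ is $$\delta_{f,s}(A)=\lim_{X\to\infty}\frac{|\{x\in A\cap \operatorname{Orb}_f(s): x\le X\}|}{|\{x\in\operatorname{Orb}_f(s): x\le X\}|},$$ provided this limit exists. -}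

module Defs where

open import Data.Nat as ℕ using (ℕ; zero; suc; ∣_-_∣)
open import Data.Integer as ℤ using (ℤ; _+_; _*_; _^_)
open import Data.Fin using (Fin; fromℕ; toℕ)
open import Data.List using (List; length)
open import Data.List.Membership.Propositional using (_∈_)
open import Data.List.Relation.Unary.Unique.Propositional using (Unique)
open import Data.Product using (Σ; _×_; ∃)
open import Relation.Binary.PropositionalEquality using (_≡_; _≢_)
open import Relation.Nullary using (¬_)

-- A polynomial of formal degree d with integer coefficients
-- c 0 , ... , c d  (f(x) = Σ_{i ≤ d} c i * x ^ i).
record Poly : Set where
  constructor poly
  field
    deg   : ℕ
    coeff : Fin (suc deg) → ℤ

open Poly public

sumFin : (n : ℕ) → (Fin n → ℤ) → ℤ
sumFin zero    h = ℤ.+ 0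
sumFin (suc n) h = h Fin.zero + sumFin n (λ i → h (Fin.suc i))

eval : Poly → ℤ → ℤ
eval f x = sumFin (suc (deg f)) (λ i → coeff f i * (x ^ toℕ i))

HasDegree : Poly → ℕ → Set
HasDegree f d = (deg f ≡ d) × (coeff f (fromℕ (deg f)) ≢ ℤ.+ 0)

iter : (ℤ → ℤ) → ℕ → ℤ → ℤ
iter h zero    x = x
iter h (suc n) x = h (iter h n x)

InOrb : Poly → ℤ → ℤ → Set
InOrb f t x = ∃ λ (n : ℕ) → x ≡ iter (eval f) n t

-- t is wandering: Orb_f(t) is infinite (not contained in any finite list)
Wandering : Poly → ℤ → Set
Wandering f t = ¬ (Σ (List ℤ) λ l → ∀ x → InOrb f t x → x ∈ l)

-- x ∈ Orb^±_g(t) for g(x) = x + a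
InOrbPM : ℤ → ℤ → ℤ → Set
InOrbPM a t x = ∃ λ (m : ℤ) → x ≡ t + m * a

IsCount : (ℤ → Set) → ℕ → Set
IsCount P c = Σ (List ℤ) λ l →
  Unique l × (∀ x → (x ∈ l → P x) × (P x → x ∈ l)) × (length l ≡ c)

-- δ_{f,t}(A) = 1 : for every ε = 1/(k+1) there is X₀ such that for all X ≥ X₀,
-- with a = #{x ∈ A ∩ Orb_f(t) : |x| ≤ X} and b = #{x ∈ Orb_f(t) : |x| ≤ X},
-- |a/b - 1| < ε, i.e. (k+1)·|a - b| < b  (this also forces b > 0).
DensityOne : Poly → ℤ → (ℤ → Set) → Set
DensityOne f t A =
  ∀ (k : ℕ) → ∃ λ (X₀ : ℕ) → ∀ (X : ℕ) → X₀ ℕ.≤ X → ∀ (a b : ℕ) →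
    IsCount (λ x → A x × InOrb f t x × (ℤ.∣ x ∣ ℕ.≤ X)) a →
    IsCount (λ x → InOrb f t x × (ℤ.∣ x ∣ ℕ.≤ X)) b →
    suc k ℕ.* ∣ a - b ∣ ℕ.< b

-- If f(t) ≡ t (mod aᵢ) for some i then, f being a polynomial, the whole orbit stays in
-- t + aᵢℤ, which gives (iii) and hence (ii) and (i).  Otherwise the set of n ≥ 1 with
-- f^n(t) ≡ t (mod aᵢ) is closed under addition for each i, so some Q ≥ 1 lies in every
-- such set that is nonempty, and then f^(1+cQ)(t) ≡ f(t) ≢ t (mod aᵢ) for all c and i:
-- the orbit points with index in 1 + Qℕ avoid the union.  As deg f ≥ 2 and t is
-- wandering, |f^n(t)| is eventually strictly increasing, so the orbit points with
-- |x| ≤ X are, up to a bounded number, an initial segment of the orbit, and at least a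
-- fraction of about 1/Q of them lies outside the union; its density is not 1.

module Submission where

open import Defs
open import Data.Nat using (ℕ; _≤_)
open import Data.Integer using (ℤ)
open import Data.Fin using (Fin)
open import Data.Product using (Σ; _×_; ∃)
open import Function.Bundles using (_⇔_)

open import Data.Nat as ℕ using (zero; suc; z≤n; s≤s; _<_; _∸_; ∣_-_∣)
import Data.Nat.Properties as ℕ
open import Data.Integer as ℤ using (∣_∣)
import Data.Integer.Properties as ℤ
open import Data.Fin as Fin using (fromℕ; toℕ; inject₁)
import Data.Fin.Properties as Fin
open import Data.List using (List; []; _∷_; length; map; filter; upTo; deduplicate; _++_)
import Data.List.Properties as List
open import Data.List.Membership.Propositional using (_∈_; _─_)
open import Data.List.Membership.Propositional.Properties
open import Data.List.Relation.Unary.Any using (here; there; index)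
open import Data.List.Relation.Unary.All as All using ()
open import Data.List.Relation.Unary.Unique.Propositional using (Unique; []; _∷_)
import Data.List.Relation.Unary.Unique.Propositional.Properties as Unique
open import Data.List.Relation.Unary.Unique.DecPropositional.Properties ℤ._≟_ using (deduplicate-!)
open import Data.List.Relation.Binary.Subset.Propositional using (_⊆_)
open import Data.List.Relation.Binary.Disjoint.Propositional using (Disjoint)
open import Data.Product using (_,_; proj₁; proj₂)
open import Data.Sum using (_⊎_; inj₁; inj₂; [_,_]′)
open import Data.Empty using (⊥-elim)
open import Function using (_∘_; _$_)
open import Function.Bundles using (mk⇔)
open import Effect.Monad using (RawMonad)
open import Relation.Nullary using (¬_; Dec; yes; no)
open import Relation.Nullary.Decidable as Dec using (¬¬-excluded-middle)
open import Relation.Nullary.Negation using (¬¬-Monad; negated-stable)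
open import Relation.Unary using (Decidable)
open import Relation.Binary.PropositionalEquality

private variable
  A : Set
  k m n B R : ℕ
  a x y x′ y′ : ℤ

module Congruence where
  open import Data.Integer using (_+_; _*_; -_; _-_; _^_; 0ℤ)
  open import Data.Integer.Tactic.RingSolver using (solve-∀)
  open import Data.Integer.Divisibility.Signed using (_∣_; _∣?_; divides)

  infix 4 _≡_mod_
  record _≡_mod_ (x y a : ℤ) : Set where
    constructor congruent
    field
      multiple : ℤ
      equation : x ≡ y + multiple * a

  progression⇒≡-mod : InOrbPM a y x → x ≡ y mod a
  progression⇒≡-mod (m , eq) = congruent m eq

  ≡-mod⇒progression : x ≡ y mod a → InOrbPM a y x
  ≡-mod⇒progression (congruent m eq) = m , eq

  ≡-mod-refl : ∀ x → x ≡ x mod a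
  ≡-mod-refl {a} x = congruent 0ℤ (identity x a)
    where identity : ∀ x a → x ≡ x + 0ℤ * a
          identity = solve-∀

  ≡-mod-sym : x ≡ y mod a → y ≡ x mod a
  ≡-mod-sym {y = y} {a} (congruent m refl) = congruent (- m) (identity y m a)
    where identity : ∀ y m a → y ≡ (y + m * a) + (- m) * a
          identity = solve-∀

  ≡-mod-trans : x ≡ y mod a → y ≡ x′ mod a → x ≡ x′ mod a
  ≡-mod-trans {a = a} {x′ = z} (congruent m refl) (congruent m′ refl) =
    congruent (m + m′) (identity z m m′ a)
    where identity : ∀ z m m′ a → (z + m′ * a) + m * a ≡ z + (m + m′) * a
          identity = solve-∀

  +-cong-mod : x ≡ y mod a → x′ ≡ y′ mod a → x + x′ ≡ y + y′ mod a
  +-cong-mod {y = y} {a} {y′ = y′} (congruent m refl) (congruent m′ refl) =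
    congruent (m + m′) (identity y y′ m m′ a)
    where identity : ∀ y y′ m m′ a → (y + m * a) + (y′ + m′ * a) ≡ (y + y′) + (m + m′) * a
          identity = solve-∀

  *-cong-mod : x ≡ y mod a → x′ ≡ y′ mod a → x * x′ ≡ y * y′ mod a
  *-cong-mod {y = y} {a} {y′ = y′} (congruent m refl) (congruent m′ refl) =
    congruent (m * y′ + y * m′ + m * m′ * a) (identity y y′ m m′ a)
    where identity : ∀ y y′ m m′ a →
                     (y + m * a) * (y′ + m′ * a) ≡ y * y′ + (m * y′ + y * m′ + m * m′ * a) * a
          identity = solve-∀

  ^-cong-mod : x ≡ y mod a → ∀ n → x ^ n ≡ y ^ n mod a
  ^-cong-mod x≡y zero    = ≡-mod-refl _
  ^-cong-mod x≡y (suc n) = *-cong-mod x≡y (^-cong-mod x≡y n)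

  sumFin-cong-mod : ∀ n {g h : Fin n → ℤ} → (∀ i → g i ≡ h i mod a) →
                     sumFin n g ≡ sumFin n h mod a
  sumFin-cong-mod zero    g≡h = ≡-mod-refl _
  sumFin-cong-mod (suc n) g≡h = +-cong-mod (g≡h Fin.zero) (sumFin-cong-mod n (g≡h ∘ Fin.suc))

  eval-cong-mod : ∀ f → x ≡ y mod a → eval f x ≡ eval f y mod a
  eval-cong-mod f x≡y =
    sumFin-cong-mod _ λ i → *-cong-mod (≡-mod-refl (coeff f i)) (^-cong-mod x≡y (toℕ i))

  iter-cong-mod : ∀ f n → x ≡ y mod a → iter (eval f) n x ≡ iter (eval f) n y mod a
  iter-cong-mod f zero    x≡y = x≡y
  iter-cong-mod f (suc n) x≡y = eval-cong-mod f (iter-cong-mod f n x≡y)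

  ≡-mod-dec : ∀ a x y → Dec (x ≡ y mod a)
  ≡-mod-dec a x y = Dec.map′ from to (a ∣? (x - y))
    where
    from : a ∣ x - y → x ≡ y mod a
    from (divides q eq) = congruent q (trans (identity x y) (cong (y +_) eq))
      where identity : ∀ x y → x ≡ y + (x - y)
            identity = solve-∀
    to : x ≡ y mod a → a ∣ x - y
    to (congruent m refl) = divides m (identity y m a)
      where identity : ∀ y m a → (y + m * a) - y ≡ m * a
            identity = solve-∀

  progression? : ∀ a t → Decidable (InOrbPM a t)
  progression? a t x = Dec.map′ ≡-mod⇒progression progression⇒≡-mod (≡-mod-dec a x t)

open Congruence

iter-+ : ∀ (h : ℤ → ℤ) m n x → iter h (m ℕ.+ n) x ≡ iter h m (iter h n x)
iter-+ h zero    n x = refl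
iter-+ h (suc m) n x = cong h (iter-+ h m n x)

module _ (f : Poly) (t : ℤ) where

  orbit : ℕ → ℤ
  orbit n = iter (eval f) n t

  Returns : ℤ → ℕ → Set
  Returns a n = orbit n ≡ t mod a

  returns-+ : Returns a m → Returns a n → Returns a (m ℕ.+ n)
  returns-+ {m = m} {n} returns-m returns-n rewrite iter-+ (eval f) m n t =
    ≡-mod-trans (iter-cong-mod f m returns-n) returns-m

  returns-* : Returns a n → ∀ m → Returns a (m ℕ.* n)
  returns-* returns-n zero    = ≡-mod-refl t
  returns-* {n = n} returns-n (suc m) = returns-+ {m = n} returns-n (returns-* returns-n m)

  returns-suc⇒fixed : Returns a n → Returns a (suc n) → Returns a 1
  returns-suc⇒fixed returns-n returns-suc-n =
    ≡-mod-trans (≡-mod-sym (eval-cong-mod f returns-n)) returns-suc-n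

  fixed⇒orbit⊆progression : Returns a 1 → ∀ x → InOrb f t x → InOrbPM a t x
  fixed⇒orbit⊆progression {a} fixed x (n , refl) = ≡-mod⇒progression $
    subst (Returns a) (ℕ.*-identityʳ n) (returns-* fixed n)

IsCommonPeriod : (Fin k → ℕ → Set) → ℕ → Set
IsCommonPeriod S P = ∀ i → (∀ n → ¬ S i (suc n)) ⊎ S i (suc P)

-- The product of one positive element from each nonempty set lies in all of them.
-- Deciding which sets are nonempty is the only non-constructive step.
common-period : (S : Fin k → ℕ → Set) → (∀ i {n} → S i n → ∀ m → S i (m ℕ.* n)) →
                ¬ ¬ ∃ (IsCommonPeriod S)
common-period {zero}  S closed = λ ¬period → ¬period (0 , λ ())
common-period {suc k} S closed = do
  P , period ← common-period (S ∘ Fin.suc) (closed ∘ Fin.suc)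
  returns? ← ¬¬-excluded-middle
  pure $ extend-period returns? P period
  where
  open RawMonad ¬¬-Monad
  extend-period : Dec (∃ λ n → S Fin.zero (suc n)) → ∀ P → IsCommonPeriod (S ∘ Fin.suc) P → ∃ (IsCommonPeriod S)
  extend-period (no never) P period = P , λ where
    Fin.zero    → inj₁ λ n s → never (n , s)
    (Fin.suc i) → period i
  extend-period (yes (n , s)) P period = P ℕ.+ n ℕ.* suc P , λ where
    Fin.zero    → inj₂ (subst (S Fin.zero) (ℕ.*-comm (suc P) (suc n)) (closed Fin.zero s (suc P)))
    (Fin.suc i) → [ inj₁ , (λ s′ → inj₂ (closed (Fin.suc i) s′ (suc n))) ]′ (period i)

smallIntegers : ℕ → List ℤ
smallIntegers R = map ℤ.+_ (upTo R) ++ map ℤ.-[1+_] (upTo R)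

∈-smallIntegers : ∀ x → ∣ x ∣ < R → x ∈ smallIntegers R
∈-smallIntegers (ℤ.+ n)    n<R = ∈-++⁺ˡ (∈-map⁺ ℤ.+_ (∈-upTo⁺ n<R))
∈-smallIntegers ℤ.-[1+ n ] n<R = ∈-++⁺ʳ _ (∈-map⁺ ℤ.-[1+_] (∈-upTo⁺ (ℕ.<-trans (ℕ.n<1+n n) n<R)))

wandering⇒unbounded : ∀ f t → Wandering f t → ∀ R → ¬ ¬ (∃ λ N → R ≤ ∣ orbit f t N ∣)
wandering⇒unbounded f t wandering R bounded =
  wandering (smallIntegers R , λ where
    x (n , refl) → ∈-smallIntegers x (ℕ.≰⇒> λ large → bounded (n , large)))

module Growth where
  open import Data.Integer using (_+_; _*_; _-_; _^_)
  open import Data.Integer.Tactic.RingSolver using (solve-∀)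
  open import Algebra.Properties.Semiring.Sum ℕ.+-*-semiring using (sum; *-distribʳ-sum)

  Expanding : Poly → ℕ → Set
  Expanding f R = ∀ x → R ≤ ∣ x ∣ → suc ∣ x ∣ ≤ ∣ eval f x ∣

  -- Once |x| ≥ S + 2, where S bounds the lower coefficients, the leading term beats the
  -- others by a factor |x|, which leaves |f x| ≥ 2 |x|^(d-1) ≥ 2 |x|.
  dominant-growth : ∀ S y Y F → S ℕ.+ 2 ≤ y → y ≤ Y → y ℕ.* Y ≤ F ℕ.+ S ℕ.* Y → suc y ≤ F
  dominant-growth S y Y F S+2≤y y≤Y yY≤F+SY = begin
    suc y      ≤⟨ ℕ.+-monoˡ-≤ y 1≤y ⟩
    y ℕ.+ y    ≡⟨ cong (y ℕ.+_) (ℕ.+-identityʳ y) ⟨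
    2 ℕ.* y    ≤⟨ ℕ.*-monoʳ-≤ 2 y≤Y ⟩
    2 ℕ.* Y    ≤⟨ ℕ.+-cancelˡ-≤ (S ℕ.* Y) _ _ SY+2Y≤SY+F ⟩
    F          ∎
    where
    open ℕ.≤-Reasoning
    1≤y : 1 ≤ y
    1≤y = ℕ.≤-trans (ℕ.m≤n+m 1 (suc S)) (subst (_≤ y) (ℕ.+-suc S 1) S+2≤y)
    SY+2Y≤SY+F : S ℕ.* Y ℕ.+ 2 ℕ.* Y ≤ S ℕ.* Y ℕ.+ F
    SY+2Y≤SY+F = subst₂ _≤_ (ℕ.*-distribʳ-+ Y S 2) (ℕ.+-comm F (S ℕ.* Y))
                   (ℕ.≤-trans (ℕ.*-monoˡ-≤ Y S+2≤y) yY≤F+SY)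

  ∣^∣ : ∀ x n → ∣ x ^ n ∣ ≡ ∣ x ∣ ℕ.^ n
  ∣^∣ x zero    = refl
  ∣^∣ x (suc n) = trans (ℤ.∣i*j∣≡∣i∣*∣j∣ x (x ^ n)) (cong (∣ x ∣ ℕ.*_) (∣^∣ x n))

  ∣j∣≤∣i+j∣+∣i∣ : ∀ i j → ∣ j ∣ ≤ ∣ i + j ∣ ℕ.+ ∣ i ∣
  ∣j∣≤∣i+j∣+∣i∣ i j =
    subst (λ w → ∣ w ∣ ≤ ∣ i + j ∣ ℕ.+ ∣ i ∣) (identity i j) (ℤ.∣i-j∣≤∣i∣+∣j∣ (i + j) i)
    where identity : ∀ i j → (i + j) - i ≡ j
          identity = solve-∀

  ∣sumFin∣≤ : ∀ n {h : Fin n → ℤ} {bound : Fin n → ℕ} → (∀ i → ∣ h i ∣ ≤ bound i) →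
             ∣ sumFin n h ∣ ≤ sum bound
  ∣sumFin∣≤ zero    _  = z≤n
  ∣sumFin∣≤ (suc n) {h} h≤ =
    ℕ.≤-trans (ℤ.∣i+j∣≤∣i∣+∣j∣ (h Fin.zero) _) (ℕ.+-mono-≤ (h≤ Fin.zero) (∣sumFin∣≤ n (h≤ ∘ Fin.suc)))

  sumFin-init-last : ∀ n (h : Fin (suc n) → ℤ) → sumFin (suc n) h ≡ sumFin n (h ∘ inject₁) + h (fromℕ n)
  sumFin-init-last zero    h = trans (ℤ.+-identityʳ (h Fin.zero)) (sym (ℤ.+-identityˡ (h Fin.zero)))
  sumFin-init-last (suc n) h =
    trans (cong (h Fin.zero +_) (sumFin-init-last n (h ∘ Fin.suc)))
          (sym (ℤ.+-assoc (h Fin.zero) (sumFin n (h ∘ Fin.suc ∘ inject₁)) (h (fromℕ (suc n)))))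

  ∣c*x^i∣≤∣c∣*∣x∣^n : ∀ c x {i n} → 1 ≤ ∣ x ∣ → i ≤ n → ∣ c * x ^ i ∣ ≤ ∣ c ∣ ℕ.* ∣ x ∣ ℕ.^ n
  ∣c*x^i∣≤∣c∣*∣x∣^n c x {i} 1≤∣x∣ i≤n =
    subst (_≤ _) (sym (trans (ℤ.∣i*j∣≡∣i∣*∣j∣ c (x ^ i)) (cong (∣ c ∣ ℕ.*_) (∣^∣ x i))))
      (ℕ.*-monoʳ-≤ ∣ c ∣ (ℕ.^-monoʳ-≤ ∣ x ∣ {{ℕ.>-nonZero 1≤∣x∣}} i≤n))

  ∣x∣^n≤∣c*x^n∣ : ∀ {c} x n → c ≢ ℤ.+ 0 → ∣ x ∣ ℕ.^ n ≤ ∣ c * x ^ n ∣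
  ∣x∣^n≤∣c*x^n∣ {c} x n c≢0 =
    subst (_ ≤_) (sym (trans (ℤ.∣i*j∣≡∣i∣*∣j∣ c (x ^ n)) (cong (∣ c ∣ ℕ.*_) (∣^∣ x n))))
      (ℕ.m≤n*m (∣ x ∣ ℕ.^ n) ∣ c ∣ {{ℕ.≢-nonZero (c≢0 ∘ ℤ.∣i∣≡0⇒i≡0)}})

  lowerSum : ∀ {D} → (Fin (suc (suc D)) → ℤ) → ℕ
  lowerSum c = sum (λ i → ∣ c (inject₁ i) ∣)

  leading-term-dominates : ∀ D (c : Fin (suc (suc D)) → ℤ) → c (fromℕ (suc D)) ≢ ℤ.+ 0 →
    ∀ x → 1 ≤ ∣ x ∣ →
    ∣ x ∣ ℕ.* ∣ x ∣ ℕ.^ D ≤ ∣ eval (poly (suc D) c) x ∣ ℕ.+ lowerSum c ℕ.* ∣ x ∣ ℕ.^ D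
  leading-term-dominates D c c≢0 x 1≤∣x∣ = begin
    ∣ x ∣ ℕ.^ suc D                 ≡⟨ cong (∣ x ∣ ℕ.^_) (Fin.toℕ-fromℕ (suc D)) ⟨
    ∣ x ∣ ℕ.^ toℕ (fromℕ (suc D))   ≤⟨ ∣x∣^n≤∣c*x^n∣ x (toℕ (fromℕ (suc D))) c≢0 ⟩
    ∣ leading ∣                     ≤⟨ ∣j∣≤∣i+j∣+∣i∣ lower leading ⟩
    ∣ lower + leading ∣ ℕ.+ ∣ lower ∣
      ≡⟨ cong (λ w → ∣ w ∣ ℕ.+ ∣ lower ∣) (sumFin-init-last (suc D) term) ⟨
    ∣ eval (poly (suc D) c) x ∣ ℕ.+ ∣ lower ∣
      ≤⟨ ℕ.+-monoʳ-≤ ∣ eval (poly (suc D) c) x ∣ lower-bound ⟩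
    ∣ eval (poly (suc D) c) x ∣ ℕ.+ lowerSum c ℕ.* ∣ x ∣ ℕ.^ D ∎
    where
    open ℕ.≤-Reasoning
    term : Fin (suc (suc D)) → ℤ
    term i = c i * x ^ toℕ i
    lower = sumFin (suc D) (term ∘ inject₁)
    leading = term (fromℕ (suc D))
    lower-bound : ∣ lower ∣ ≤ lowerSum c ℕ.* ∣ x ∣ ℕ.^ D
    lower-bound =
      subst (∣ lower ∣ ≤_) (sym (*-distribʳ-sum (∣ x ∣ ℕ.^ D) (λ i → ∣ c (inject₁ i) ∣)))
        (∣sumFin∣≤ (suc D) {term ∘ inject₁} λ i → ∣c*x^i∣≤∣c∣*∣x∣^n (c (inject₁ i)) x 1≤∣x∣
          (subst (_≤ D) (sym (Fin.toℕ-inject₁ i)) (Fin.toℕ≤pred[n] i)))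

  degree≥2⇒expanding : ∀ {f d} → HasDegree f d → 2 ≤ d → ∃ (Expanding f)
  degree≥2⇒expanding {poly (suc (suc E)) c} (refl , c≢0) (s≤s (s≤s _)) =
    lowerSum c ℕ.+ 2 , λ x large →
      let 1≤∣x∣ = ℕ.≤-trans (ℕ.m≤n+m 1 (suc (lowerSum c)))
                             (subst (_≤ ∣ x ∣) (ℕ.+-suc (lowerSum c) 1) large)
      in dominant-growth (lowerSum c) ∣ x ∣ (∣ x ∣ ℕ.^ suc E) _ large
           (ℕ.m≤m*n ∣ x ∣ (∣ x ∣ ℕ.^ E) {{ℕ.m^n≢0 ∣ x ∣ E {{ℕ.>-nonZero 1≤∣x∣}}}})
           (leading-term-dominates (suc E) c c≢0 x 1≤∣x∣)

open Growth using (Expanding; degree≥2⇒expanding)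

module _ (f : Poly) {R : ℕ} (expanding : Expanding f R) (t : ℤ) where

  expanding⇒stays-large : R ≤ ∣ orbit f t m ∣ → m ≤ n → R ≤ ∣ orbit f t n ∣
  expanding⇒stays-large {n = zero}  large z≤n   = large
  expanding⇒stays-large {n = suc n} large m≤1+n with ℕ.m≤n⇒m<n∨m≡n m≤1+n
  ... | inj₂ refl        = large
  ... | inj₁ (s≤s m≤n) = ℕ.≤-trans large′ (ℕ.≤-trans (ℕ.n≤1+n _) (expanding (orbit f t n) large′))
    where large′ = expanding⇒stays-large large m≤n

  expanding⇒increasing : R ≤ ∣ orbit f t B ∣ → ∀ n → B ≤ n → ∣ orbit f t n ∣ < ∣ orbit f t (suc n) ∣
  expanding⇒increasing large n B≤n = expanding (orbit f t n) (expanding⇒stays-large large B≤n)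

module _ {h : ℕ → ℕ} {B : ℕ} (increasing : ∀ n → B ≤ n → h n < h (suc n)) where

  increasing-< : B ≤ m → m < n → h m < h n
  increasing-< {m} {suc n} B≤m (s≤s m≤n) with ℕ.m≤n⇒m<n∨m≡n m≤n
  ... | inj₁ m<n  = ℕ.<-trans (increasing-< B≤m m<n) (increasing n (ℕ.≤-trans B≤m m≤n))
  ... | inj₂ refl = increasing m B≤m

  increasing-≤ : B ≤ m → m ≤ n → h m ≤ h n
  increasing-≤ B≤m m≤n with ℕ.m≤n⇒m<n∨m≡n m≤n
  ... | inj₁ m<n  = ℕ.<⇒≤ (increasing-< B≤m m<n)
  ... | inj₂ refl = ℕ.≤-refl

  increasing-index : B ≤ m → h n ≤ h m → n ≤ m
  increasing-index B≤m hn≤hm = ℕ.≮⇒≥ λ m<n → ℕ.<⇒≱ (increasing-< B≤m m<n) hn≤hm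

  increasing-injective : B ≤ m → B ≤ n → h m ≡ h n → m ≡ n
  increasing-injective B≤m B≤n hm≡hn =
    ℕ.≤-antisym (increasing-index B≤n (ℕ.≤-reflexive hm≡hn))
                (increasing-index B≤m (ℕ.≤-reflexive (sym hm≡hn)))

  increasing-unbounded : ∀ j → j ≤ h (j ℕ.+ B)
  increasing-unbounded zero    = z≤n
  increasing-unbounded (suc j) =
    ℕ.≤-trans (s≤s (increasing-unbounded j)) (increasing (j ℕ.+ B) (ℕ.m≤n+m B j))

∈-─ : ∀ {x z : A} {ys} (x∈ys : x ∈ ys) → z ∈ ys → z ≢ x → z ∈ ys ─ x∈ys
∈-─ (here refl) (here refl) z≢x = ⊥-elim (z≢x refl)
∈-─ (here _)    (there z∈ys) _   = z∈ys
∈-─ (there _)   (here refl) _    = here refl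
∈-─ (there x∈ys) (there z∈ys) z≢x = there (∈-─ x∈ys z∈ys z≢x)

unique-length-≤ : ∀ {xs ys : List A} → Unique xs → xs ⊆ ys → length xs ≤ length ys
unique-length-≤ {xs = []}     _                 _     = z≤n
unique-length-≤ {xs = x ∷ xs} {ys} (x∉xs ∷ unique) xs⊆ys =
  subst (suc (length xs) ≤_) (sym (List.length-removeAt′ ys (index x∈ys)))
    (s≤s (unique-length-≤ unique λ z∈xs →
      ∈-─ x∈ys (xs⊆ys (there z∈xs)) λ z≡x → All.lookup x∉xs z∈xs (sym z≡x)))
  where x∈ys = xs⊆ys (here refl)

private variable
  U V : ℤ → Set
  b c : ℕ
  l : List ℤ

count-≤-length : IsCount U c → (∀ {x} → U x → x ∈ l) → c ≤ length l
count-≤-length (_ , unique , members , refl) U⊆l =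
  unique-length-≤ unique λ {x} x∈ → U⊆l (proj₁ (members x) x∈)

length-≤-count : Unique l → (∀ {x} → x ∈ l → U x) → IsCount U c → length l ≤ c
length-≤-count unique l⊆U (_ , _ , members , refl) =
  unique-length-≤ unique λ {x} x∈l → proj₂ (members x) (l⊆U x∈l)

count-mono : (∀ {x} → U x → V x) → IsCount U b → IsCount V c → b ≤ c
count-mono U⊆V (_ , unique , members , refl) =
  length-≤-count unique λ {x} x∈ → U⊆V (proj₁ (members x) x∈)

count-of-list : (∀ {x} → x ∈ l → U x) → (∀ {x} → U x → x ∈ l) →
                IsCount U (length (deduplicate ℤ._≟_ l))
count-of-list {l} l⊆U U⊆l =
  deduplicate ℤ._≟_ l , deduplicate-! l ,
  (λ x → l⊆U ∘ ∈-deduplicate⁻ ℤ._≟_ l , ∈-deduplicate⁺ ℤ._≟_ ∘ U⊆l) , refl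

count-∩ : Decidable V → IsCount U c → ∃ λ b → IsCount (λ x → V x × U x) b
count-∩ V? (l , unique , members , refl) =
  length (filter V? l) , filter V? l , Unique.filter⁺ V? unique ,
  (λ x → (λ x∈ → let x∈l , v = ∈-filter⁻ V? x∈ in v , proj₁ (members x) x∈l)
       , (λ (v , u) → ∈-filter⁺ V? (proj₂ (members x) u) v)) ,
  refl

count-∩-+-≤ : IsCount (λ x → V x × U x) b → IsCount U c → Unique l →
              (∀ {x} → x ∈ l → U x × ¬ V x) → b ℕ.+ length l ≤ c
count-∩-+-≤ {U = U} {l = l} (l′ , unique′ , members′ , refl) count-U unique l⊆U∖V =
  subst (_≤ _) (List.length-++ l′) (length-≤-count (Unique.++⁺ unique′ unique disjoint) ⊆U count-U)
  where
  disjoint : Disjoint l′ l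
  disjoint (x∈l′ , x∈l) = proj₂ (l⊆U∖V x∈l) (proj₁ (proj₁ (members′ _) x∈l′))
  ⊆U : ∀ {x} → x ∈ l′ ++ l → U x
  ⊆U x∈ = [ (λ x∈l′ → proj₂ (proj₁ (members′ _) x∈l′)) , (λ x∈l → proj₁ (l⊆U∖V x∈l)) ]′ (∈-++⁻ l′ x∈)

n≤m≤k⇒∣m-k∣≤∣n-k∣ : n ≤ m → m ≤ k → ∣ m - k ∣ ≤ ∣ n - k ∣
n≤m≤k⇒∣m-k∣≤∣n-k∣ {k = k} n≤m m≤k =
  subst₂ _≤_ (sym (ℕ.m≤n⇒∣m-n∣≡n∸m m≤k)) (sym (ℕ.m≤n⇒∣m-n∣≡n∸m (ℕ.≤-trans n≤m m≤k)))
    (ℕ.∸-monoʳ-≤ k n≤m)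

-- With c of the b orbit points in the set and at least W outside it, the relative
-- error (b - c)/b is at least W/b, which is not below 1/(Q+1) once b ≤ W·Q + B + 1 and B < W.
density-gap : ∀ B W Q → B < W → b ≤ suc (W ℕ.* Q ℕ.+ B) → c ℕ.+ W ≤ b → b ≤ suc Q ℕ.* ∣ c - b ∣
density-gap {b} {c} B W Q B<W b≤ c+W≤b = begin
  b                     ≤⟨ b≤ ⟩
  suc (W ℕ.* Q ℕ.+ B)   ≡⟨ ℕ.+-suc (W ℕ.* Q) B ⟨
  W ℕ.* Q ℕ.+ suc B     ≤⟨ ℕ.+-monoʳ-≤ (W ℕ.* Q) B<W ⟩
  W ℕ.* Q ℕ.+ W         ≡⟨ trans (ℕ.+-comm (W ℕ.* Q) W) (cong (W ℕ.+_) (ℕ.*-comm W Q)) ⟩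
  suc Q ℕ.* W           ≤⟨ ℕ.*-monoʳ-≤ (suc Q) W≤∣c-b∣ ⟩
  suc Q ℕ.* ∣ c - b ∣   ∎
  where
  open ℕ.≤-Reasoning
  W≤∣c-b∣ : W ≤ ∣ c - b ∣
  W≤∣c-b∣ = ℕ.≤-trans (ℕ.m+n≤o⇒m≤o∸n W (subst (_≤ b) (ℕ.+-comm c W) c+W≤b))
              (subst (b ∸ c ≤_) (ℕ.∣-∣-comm b c) (ℕ.m∸n≤∣m-n∣ b c))

module _ (f : Poly) (t : ℤ) where

  DensityOne-mono : Decidable U → (∀ {x} → U x → V x) → DensityOne f t U → DensityOne f t V
  DensityOne-mono U? U⊆V dense K with dense K
  ... | X₀ , bound = X₀ , λ X X₀≤X c b count-V count-all →
    let d , count-U = count-∩ U? count-all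
    in ℕ.≤-<-trans
         (ℕ.*-monoʳ-≤ (suc K)
           (n≤m≤k⇒∣m-k∣≤∣n-k∣ (count-mono (λ (u , rest) → U⊆V u , rest) count-U count-V)
                                (count-mono proj₂ count-V count-all)))
         (bound X X₀≤X d b count-U count-all)

  orbit⊆⇒DensityOne : (∀ x → InOrb f t x → V x) → DensityOne f t V
  orbit⊆⇒DensityOne orbit⊆V K = ∣ t ∣ , λ X ∣t∣≤X c b count-V count-all →
    let c≡b = ℕ.≤-antisym (count-mono proj₂ count-V count-all)
                          (count-mono (λ (o , bounded) → orbit⊆V _ o , o , bounded) count-all count-V)
        0<b = length-≤-count (All.[] ∷ []) (λ where (here refl) → (0 , refl) , ∣t∣≤X) count-all
        open ℕ.≤-Reasoning
    in begin-strict
      suc K ℕ.* ∣ c - b ∣ ≡⟨ cong (suc K ℕ.*_) (ℕ.m≡n⇒∣m-n∣≡0 c≡b) ⟩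
      suc K ℕ.* 0         ≡⟨ ℕ.*-zeroʳ (suc K) ⟩
      0                   <⟨ 0<b ⟩
      b                   ∎

  module _ {B : ℕ} (increasing : ∀ n → B ≤ n → ∣ orbit f t n ∣ < ∣ orbit f t (suc n) ∣) where

    orbit-ball-count : ∀ M → B ≤ M →
      ∃ λ b → IsCount (λ x → InOrb f t x × ∣ x ∣ ≤ ∣ orbit f t M ∣) b × b ≤ suc M
    orbit-ball-count M B≤M =
      _ , count ,
      subst (length (deduplicate ℤ._≟_ ball) ≤_) length-orbits
        (count-≤-length {l = orbits} count (proj₁ ∘ ∈-filter⁻ bounded? ∘ ball⊆))
      where
      bounded? : Decidable (λ x → ∣ x ∣ ≤ ∣ orbit f t M ∣)
      bounded? x = ∣ x ∣ ℕ.≤? ∣ orbit f t M ∣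
      orbits : List ℤ
      orbits = map (orbit f t) (upTo (suc M))
      length-orbits : length orbits ≡ suc M
      length-orbits = trans (List.length-map (orbit f t) (upTo (suc M))) (List.length-upTo (suc M))
      ball : List ℤ
      ball = filter bounded? orbits
      ⊆ball : ∀ {x} → x ∈ ball → InOrb f t x × ∣ x ∣ ≤ ∣ orbit f t M ∣
      ⊆ball x∈ with x∈orbits , x-bounded ← ∈-filter⁻ bounded? {xs = orbits} x∈
                 with n , _ , x≡ ← ∈-map⁻ (orbit f t) {xs = upTo (suc M)} x∈orbits = (n , x≡) , x-bounded
      ball⊆ : ∀ {x} → InOrb f t x × ∣ x ∣ ≤ ∣ orbit f t M ∣ → x ∈ ball
      ball⊆ ((n , refl) , n-bounded) =
        ∈-filter⁺ bounded? (∈-map⁺ (orbit f t) (∈-upTo⁺ (s≤s n≤M))) n-bounded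
        where n≤M = increasing-index increasing {n = n} B≤M n-bounded
      count : IsCount (λ x → InOrb f t x × ∣ x ∣ ≤ ∣ orbit f t M ∣) (length (deduplicate ℤ._≟_ ball))
      count = count-of-list ⊆ball ball⊆

    progression-avoiding⇒¬DensityOne : Decidable U → ∀ P →
      (∀ c → ¬ U (orbit f t (c ℕ.* suc P ℕ.+ B))) → ¬ DensityOne f t U
    progression-avoiding⇒¬DensityOne {U} U? P avoids dense =
      ℕ.<⇒≱ (bound X X₀≤X hits total count-U count-ball)
            (density-gap B W Q (s≤s (ℕ.m≤m+n B X₀)) total≤
              (subst (λ w → hits ℕ.+ w ≤ total) length-avoided
                 (count-∩-+-≤ count-U count-ball unique-avoided avoided⊆)))
      where
      Q = suc P
      X₀ = proj₁ (dense Q)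
      bound = proj₂ (dense Q)
      W = suc (B ℕ.+ X₀)
      M = W ℕ.* Q ℕ.+ B
      X = ∣ orbit f t M ∣
      ball = orbit-ball-count M (ℕ.m≤n+m B (W ℕ.* Q))
      total = proj₁ ball
      count-ball = proj₁ (proj₂ ball)
      total≤ = proj₂ (proj₂ ball)
      in-U = count-∩ U? count-ball
      hits = proj₁ in-U
      count-U = proj₂ in-U
      X₀≤X : X₀ ≤ X
      X₀≤X = ℕ.≤-trans (ℕ.≤-trans (ℕ.m≤n+m X₀ B) (ℕ.n≤1+n _))
               (ℕ.≤-trans (ℕ.m≤m*n W Q) (increasing-unbounded increasing (W ℕ.* Q)))
      time : ℕ → ℕ
      time c = c ℕ.* Q ℕ.+ B
      avoided : List ℤ
      avoided = map (orbit f t ∘ time) (upTo W)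
      length-avoided : length avoided ≡ W
      length-avoided = trans (List.length-map (orbit f t ∘ time) (upTo W)) (List.length-upTo W)
      unique-avoided : Unique avoided
      unique-avoided = Unique.map⁺ (λ {c} {c′} eq →
        ℕ.*-cancelʳ-≡ c c′ Q (ℕ.+-cancelʳ-≡ B _ _
          (increasing-injective increasing (ℕ.m≤n+m B _) (ℕ.m≤n+m B _) (cong ∣_∣ eq))))
        (Unique.upTo⁺ W)
      avoided⊆ : ∀ {x} → x ∈ avoided → (InOrb f t x × ∣ x ∣ ≤ X) × ¬ U x
      avoided⊆ x∈ with c , c∈ , refl ← ∈-map⁻ (orbit f t ∘ time) {xs = upTo W} x∈ =
        ((time c , refl) ,
         increasing-≤ increasing (ℕ.m≤n+m B _) (ℕ.+-monoˡ-≤ B (ℕ.*-monoˡ-≤ Q (ℕ.<⇒≤ (∈-upTo⁻ c∈))))) ,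
        avoids c

Union : (Fin k → ℤ) → ℤ → ℤ → Set
Union a t x = ∃ λ i → InOrbPM (a i) t x

union? : ∀ (a : Fin k → ℤ) t → Decidable (Union a t)
union? a t x = Fin.any? λ i → progression? (a i) t x

module _ (f : Poly) (t : ℤ) (a : Fin k → ℤ) (unfixed : ∀ i → ¬ Returns f t (a i) 1) where

  -- f^(1 + cQ)(t) = f(f^(cQ)(t)) ≡ f(t) ≢ t modulo every aᵢ for which Q is a return time.
  period-avoids-union : ∀ P → IsCommonPeriod (λ i → Returns f t (a i)) P →
                        ∀ c → ¬ Union a t (orbit f t (suc (c ℕ.* suc P)))
  period-avoids-union P period c (i , returns) with period i
  ... | inj₁ never     = never (c ℕ.* suc P) (progression⇒≡-mod returns)
  ... | inj₂ returns-P = unfixed i $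
    returns-suc⇒fixed f t {n = c ℕ.* suc P} (returns-* f t returns-P c) (progression⇒≡-mod returns)

  unfixed⇒¬DensityOne-union : ∀ {R} → Expanding f R → Wandering f t → ¬ DensityOne f t (Union a t)
  unfixed⇒¬DensityOne-union {R} expanding wandering = negated-stable do
    N , large ← wandering⇒unbounded f t wandering R
    P , period ← common-period (λ i → Returns f t (a i)) (λ i → returns-* f t)
    let Q = suc P
        large′ = expanding⇒stays-large f expanding t large (ℕ.m≤n⇒m≤1+n (ℕ.m≤m*n N Q))
        realign : ∀ c → c ℕ.* Q ℕ.+ suc (N ℕ.* Q) ≡ suc ((c ℕ.+ N) ℕ.* Q)
        realign c = trans (ℕ.+-suc (c ℕ.* Q) (N ℕ.* Q)) (cong suc (sym (ℕ.*-distribʳ-+ Q c N)))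
    pure $ progression-avoiding⇒¬DensityOne f t (expanding⇒increasing f expanding t large′) (union? a t) P λ c →
      subst (λ n → ¬ Union a t (orbit f t n)) (sym (realign c)) (period-avoids-union P period (c ℕ.+ N))
    where open RawMonad ¬¬-Monad

DensityOne-union⇒fixed : ∀ f {R} → Expanding f R → ∀ t → Wandering f t → (a : Fin k → ℤ) →
                         DensityOne f t (Union a t) → ∃ λ i → Returns f t (a i) 1
DensityOne-union⇒fixed f expanding t wandering a dense =
  Dec.decidable-stable (Fin.any? λ i → ≡-mod-dec (a i) (eval f t) t) λ unfixed →
    unfixed⇒¬DensityOne-union f t a (λ i fixed → unfixed (i , fixed)) expanding wandering dense

theorem5p2 : (f : Poly) (d : ℕ) → HasDegree f d → 2 ≤ d →
    (t : ℤ) → Wandering f t →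
    (k : ℕ) (a : Fin k → ℤ) →
    (DensityOne f t (λ x → ∃ λ (i : Fin k) → InOrbPM (a i) t x)
      ⇔ (∃ λ (i : Fin k) → DensityOne f t (InOrbPM (a i) t)))
    × ((∃ λ (i : Fin k) → DensityOne f t (InOrbPM (a i) t))
      ⇔ (∃ λ (i : Fin k) → ∀ x → InOrb f t x → InOrbPM (a i) t x))
theorem5p2 f d degree 2≤d t wandering k a =
  mk⇔ (iii⇒ii ∘ fixed⇒iii ∘ i⇒fixed) ii⇒i , mk⇔ (fixed⇒iii ∘ i⇒fixed ∘ ii⇒i) iii⇒ii
  where
  i⇒fixed : DensityOne f t (Union a t) → ∃ λ i → Returns f t (a i) 1
  i⇒fixed = DensityOne-union⇒fixed f (proj₂ (degree≥2⇒expanding {f} degree 2≤d)) t wandering a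
  fixed⇒iii : (∃ λ i → Returns f t (a i) 1) → ∃ λ i → ∀ x → InOrb f t x → InOrbPM (a i) t x
  fixed⇒iii (i , fixed) = i , fixed⇒orbit⊆progression f t fixed
  iii⇒ii : (∃ λ i → ∀ x → InOrb f t x → InOrbPM (a i) t x) → ∃ λ i → DensityOne f t (InOrbPM (a i) t)
  iii⇒ii (i , orbit⊆) = i , orbit⊆⇒DensityOne f t orbit⊆
  ii⇒i : (∃ λ i → DensityOne f t (InOrbPM (a i) t)) → DensityOne f t (Union a t)
  ii⇒i (i , dense) = DensityOne-mono f t (progression? (a i) t) (i ,_) dense
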